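{- If $G$ is a connected graph of order at least two and $H$ is a graph (with at least one vertex), then $$\chi_\mu(G)\le\chi_\mu(G\odot H)\le\chi_\mu(G)+1.$$
   Context: For $V(G)=\{v_1,\dots,v_n\}$, the corona product $G\odot H$ is obtained from one copy of $G$ and $n$ disjoint copies $H^1,\dots,H^n$ of $H$ by adding, for each $i\in\{1,\dots,n\}$, all edges between $v_i$ and every vertex of $H^i$. For a connected graph $G$ and $S\subseteq V(G)$, two vertices $x,y\in S$ are $S$-visible if there is a shortest $x,y$-path $P$ in $G$ with $V(P)\cap S=\{x,y\}$. $S$ is a mutual-visibility set if any two vertices of $S$ are $S$-visible. A mutual-visibility coloring of $G$ is a partition of $V(G)$ into mutual-visibility sets, and the mutual-visibility chromatic number $\chi_\mu(G)$ is the smallest number of classes in such a partition. -}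

module Defs where

open import Data.Nat using (ℕ; zero; suc; _≤_)
open import Data.Fin using (Fin)
open import Data.Product using (Σ; _×_; _,_; ∃)
open import Data.Sum using (_⊎_; inj₁; inj₂)
open import Data.List using (List; []; _∷_)
open import Data.List.Membership.Propositional using (_∈_)
open import Data.Empty using (⊥)
open import Relation.Nullary using (¬_)
open import Relation.Binary.PropositionalEquality using (_≡_; refl; sym)
open import Function.Bundles using (_↔_)

record Graph : Set₁ where
  field
    V     : Set
    _~_   : V → V → Set
    ~-sym : ∀ {x y} → x ~ y → y ~ x
    ~-irr : ∀ {x} → ¬ (x ~ x)

open Graph public

Finite : Graph → Set
Finite G = Σ ℕ λ n → V G ↔ Fin n

OrderAtLeastTwo : Graph → Set
OrderAtLeastTwo G = Σ (V G) λ x → Σ (V G) λ y → ¬ (x ≡ y)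

data Walk (G : Graph) : V G → V G → Set where
  []  : ∀ {x} → Walk G x x
  _∷_ : ∀ {x y z} → _~_ G x y → Walk G y z → Walk G x z

wlength : ∀ {G x y} → Walk G x y → ℕ
wlength []       = zero
wlength (_ ∷ w)  = suc (wlength w)

verts : ∀ {G x y} → Walk G x y → List (V G)
verts {x = x} []      = x ∷ []
verts {x = x} (_ ∷ w) = x ∷ verts w

Connected : Graph → Set
Connected G = ∀ (x y : V G) → Walk G x y

-- A shortest x,y-path: a walk from x to y of minimum length
-- (a minimum-length walk is automatically a path).
IsShortest : ∀ {G x y} → Walk G x y → Set
IsShortest {G} {x} {y} P = ∀ (Q : Walk G x y) → wlength P ≤ wlength Q

Visible : (G : Graph) → (V G → Set) → V G → V G → Set
Visible G S x y =
  Σ (Walk G x y) λ P → IsShortest P ×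
    (∀ v → v ∈ verts P → S v → (v ≡ x) ⊎ (v ≡ y))

MutualVisibility : (G : Graph) → (V G → Set) → Set
MutualVisibility G S = ∀ x y → S x → S y → ¬ (x ≡ y) → Visible G S x y

MVColorable : Graph → ℕ → Set
MVColorable G k =
  Σ (V G → Fin k) λ c → ∀ (i : Fin k) → MutualVisibility G (λ v → c v ≡ i)

IsChiMu : Graph → ℕ → Set
IsChiMu G k = MVColorable G k × (∀ j → MVColorable G j → k ≤ j)

-- Corona product G ⊙ H.
-- Vertices: inj₁ v (the copy of G) and inj₂ (i , h) (vertex h of the copy H^i).
coronaAdj : (G H : Graph) → V G ⊎ (V G × V H) → V G ⊎ (V G × V H) → Set
coronaAdj G H (inj₁ a)       (inj₁ b)        = _~_ G a b
coronaAdj G H (inj₁ a)       (inj₂ (i , h))  = a ≡ i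
coronaAdj G H (inj₂ (i , h)) (inj₁ a)        = i ≡ a
coronaAdj G H (inj₂ (i , h)) (inj₂ (j , h')) = (i ≡ j) × _~_ H h h'

coronaSym : (G H : Graph) → ∀ {x y} → coronaAdj G H x y → coronaAdj G H y x
coronaSym G H {inj₁ a}       {inj₁ b}       e         = ~-sym G e
coronaSym G H {inj₁ a}       {inj₂ (i , h)} e         = sym e
coronaSym G H {inj₂ (i , h)} {inj₁ a}       e         = sym e
coronaSym G H {inj₂ (i , h)} {inj₂ (j , k)} (p , e)   = sym p , ~-sym H e

coronaIrr : (G H : Graph) → ∀ {x} → ¬ coronaAdj G H x x
coronaIrr G H {inj₁ a}       e       = ~-irr G e
coronaIrr G H {inj₂ (i , h)} (_ , e) = ~-irr H e

_⊙_ : Graph → Graph → Graph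
G ⊙ H = record
  { V     = V G ⊎ (V G × V H)
  ; _~_   = coronaAdj G H
  ; ~-sym = λ {x} {y} → coronaSym G H {x} {y}
  ; ~-irr = λ {x} → coronaIrr G H {x}
  }

-- Projecting a walk of G ⊙ H onto G (each vertex of H^i goes to v_i) never increases its length,
-- and strictly decreases it as soon as the walk touches a leaf. Hence shortest walks between
-- vertices of G stay inside G and are shortest in G, so every mutual-visibility colouring of
-- G ⊙ H restricts to one of G. Conversely, a colouring of G extends by one new colour shared by
-- all leaves: two leaves see each other through their edge, or else through v_i, a shortest
-- v_i,v_j-path of G and v_j, whose interior avoids the leaves.
-- Shortest paths exist and adjacency is decidable only classically, so the upper bound is proved
-- under double negation and read off at the end because ≤ on ℕ is decidable.
module Submission where

open import Defs
open import Level using (0ℓ)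
open import Data.Nat using (ℕ; zero; suc; _≤_; _<_; z≤n; s≤s; s≤s⁻¹; _≤?_)
open import Data.Nat.Properties using (≤-trans; ≤-refl; n≤1+n; <⇒≱; ≮⇒≥; module ≤-Reasoning)
open import Data.Fin using (Fin; zero; suc)
open import Data.Fin.Properties using (suc-injective)
open import Data.Product using (Σ; _×_; _,_)
open import Data.Sum using (_⊎_; inj₁; inj₂)
import Data.Sum as Sum
open import Data.Sum.Properties using (inj₁-injective)
open import Data.List using (_∷_; map)
open import Data.List.Membership.Propositional using (_∈_)
open import Data.List.Membership.Propositional.Properties using (∈-map⁺; ∈-map⁻)
open import Data.List.Relation.Unary.Any using (here; there)
open import Data.Empty using (⊥-elim)
open import Effect.Monad using (RawMonad)
open import Function using (id; _∘_)
open import Function.Bundles using (_↔_; Inverse)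
open import Relation.Nullary using (¬_; Dec; yes; no)
open import Relation.Nullary.Negation using (¬¬-Monad; ¬¬-map)
open import Relation.Nullary.Negation.Core using (DoubleNegation)
open import Relation.Nullary.Decidable using (decidable-stable; ¬¬-excluded-middle)
open import Relation.Binary.PropositionalEquality using (_≡_; refl; sym; trans; cong; subst)

open RawMonad (¬¬-Monad {a = 0ℓ})

¬¬-pull-Fin : ∀ {n} {P : Fin n → Set} → (∀ k → DoubleNegation (P k)) →
              DoubleNegation (∀ k → P k)
¬¬-pull-Fin {zero}  f = pure λ ()
¬¬-pull-Fin {suc n} f = do
  p₀ ← f zero
  p₊ ← ¬¬-pull-Fin (λ k → f (suc k))
  pure λ { zero → p₀ ; (suc k) → p₊ k }

¬¬-pull : ∀ {A : Set} {P : A → Set} → Σ ℕ (λ n → A ↔ Fin n) →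
          (∀ a → DoubleNegation (P a)) → DoubleNegation (∀ a → P a)
¬¬-pull {P = P} (_ , A↔Fin) f = do
  g ← ¬¬-pull-Fin (λ k → f (from k))
  pure λ a → subst P (strictlyInverseʳ a) (g (to a))
  where open Inverse A↔Fin

Shortest : (K : Graph) → V K → V K → Set
Shortest K x y = Σ (Walk K x y) IsShortest

¬¬-shortest : ∀ {K : Graph} {x y} → Walk K x y → DoubleNegation (Shortest K x y)
¬¬-shortest {K} {x} {y} W = below (wlength W) W ≤-refl
  where
  below : ∀ n (W : Walk K x y) → wlength W ≤ n → DoubleNegation (Shortest K x y)
  below zero    W ∣W∣≤0 = pure (W , λ _ → ≤-trans ∣W∣≤0 z≤n)
  below (suc n) W ∣W∣≤n = do
    shorter? ← ¬¬-excluded-middle {A = Σ (Walk K x y) λ Q → wlength Q < wlength W}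
    case shorter?
    where
    case : Dec (Σ (Walk K x y) λ Q → wlength Q < wlength W) → DoubleNegation (Shortest K x y)
    case (yes (Q , ∣Q∣<∣W∣)) = below n Q (s≤s⁻¹ (≤-trans ∣Q∣<∣W∣ ∣W∣≤n))
    case (no none)           = pure (W , λ Q → ≮⇒≥ λ ∣Q∣<∣W∣ → none (Q , ∣Q∣<∣W∣))

edge-shortest : ∀ {K : Graph} {x y} → ¬ x ≡ y → (e : _~_ K x y) → IsShortest {K} (e ∷ [])
edge-shortest x≢y e []      = ⊥-elim (x≢y refl)
edge-shortest x≢y e (_ ∷ _) = s≤s z≤n

_∷ʳ_ : ∀ {K : Graph} {x y z} → Walk K x y → _~_ K y z → Walk K x z
[]      ∷ʳ e = e ∷ []
(d ∷ W) ∷ʳ e = d ∷ (W ∷ʳ e)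

wlength-∷ʳ : ∀ {K : Graph} {x y z} (W : Walk K x y) (e : _~_ K y z) →
             wlength (W ∷ʳ e) ≡ suc (wlength W)
wlength-∷ʳ []      e = refl
wlength-∷ʳ (d ∷ W) e = cong suc (wlength-∷ʳ W e)

∈-verts-∷ʳ⁻ : ∀ {K : Graph} {x y z v} (W : Walk K x y) (e : _~_ K y z) →
              v ∈ verts (W ∷ʳ e) → v ∈ verts W ⊎ v ≡ z
∈-verts-∷ʳ⁻ []      e (here v≡x)         = inj₁ (here v≡x)
∈-verts-∷ʳ⁻ []      e (there (here v≡z)) = inj₂ v≡z
∈-verts-∷ʳ⁻ (d ∷ W) e (here v≡x)         = inj₁ (here v≡x)
∈-verts-∷ʳ⁻ (d ∷ W) e (there v∈)         = Sum.map there id (∈-verts-∷ʳ⁻ W e v∈)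

module Corona (G H : Graph) where

  base : V (G ⊙ H) → V G
  base (inj₁ a)       = a
  base (inj₂ (i , _)) = i

  leaf : V G → V H → V (G ⊙ H)
  leaf i h = inj₂ (i , h)

  lift : ∀ {a b} → Walk G a b → Walk (G ⊙ H) (inj₁ a) (inj₁ b)
  lift []      = []
  lift (e ∷ W) = e ∷ lift W

  wlength-lift : ∀ {a b} (W : Walk G a b) → wlength (lift W) ≡ wlength W
  wlength-lift []      = refl
  wlength-lift (e ∷ W) = cong suc (wlength-lift W)

  verts-lift : ∀ {a b} (W : Walk G a b) → verts (lift W) ≡ map inj₁ (verts W)
  verts-lift []      = refl
  verts-lift (e ∷ W) = cong (_ ∷_) (verts-lift W)

  project : ∀ {u w} → Walk (G ⊙ H) u w → Walk G (base u) (base w)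
  project []                                       = []
  project (_∷_ {inj₁ _} {inj₁ _} e          Q) = e ∷ project Q
  project (_∷_ {inj₁ _} {inj₂ _} refl       Q) = project Q
  project (_∷_ {inj₂ _} {inj₁ _} refl       Q) = project Q
  project (_∷_ {inj₂ _} {inj₂ _} (refl , _) Q) = project Q

  wlength-project-∷ : ∀ {u z w} (e : _~_ (G ⊙ H) u z) (Q : Walk (G ⊙ H) z w) →
                      wlength (project (_∷_ {x = u} e Q)) ≤ suc (wlength (project Q))
  wlength-project-∷ {inj₁ _} {inj₁ _} e          Q = ≤-refl
  wlength-project-∷ {inj₁ _} {inj₂ _} refl       Q = n≤1+n _
  wlength-project-∷ {inj₂ _} {inj₁ _} refl       Q = n≤1+n _
  wlength-project-∷ {inj₂ _} {inj₂ _} (refl , _) Q = n≤1+n _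

  wlength-project : ∀ {u w} (Q : Walk (G ⊙ H) u w) → wlength (project Q) ≤ wlength Q
  wlength-project []                = z≤n
  wlength-project (_∷_ {x = u} e Q) = ≤-trans (wlength-project-∷ {u} e Q) (s≤s (wlength-project Q))

  wlength-project-into-leaf : ∀ {u z j h} (e : _~_ (G ⊙ H) u z) (Q : Walk (G ⊙ H) z (leaf j h)) →
                              wlength (project (_∷_ {x = u} e Q)) ≤ wlength Q
  wlength-project-into-leaf {inj₁ _} refl       [] = z≤n
  wlength-project-into-leaf {inj₂ _} (refl , _) [] = z≤n
  wlength-project-into-leaf {u} e (_∷_ {x = z} d Q) =
    ≤-trans (wlength-project-∷ {u} e (d ∷ Q)) (s≤s (wlength-project-into-leaf {z} d Q))

  wlength-project-between-leaves :
    ∀ {i h j h'} (Q : Walk (G ⊙ H) (leaf i h) (leaf j h')) →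
    ¬ leaf i h ≡ leaf j h' → ¬ _~_ (G ⊙ H) (leaf i h) (leaf j h') →
    suc (suc (wlength (project Q))) ≤ wlength Q
  wlength-project-between-leaves []                                     ne na = ⊥-elim (ne refl)
  wlength-project-between-leaves (_∷_ {y = inj₁ _} refl (e ∷ Q))       ne na =
    s≤s (s≤s (wlength-project-into-leaf {inj₁ _} e Q))
  wlength-project-between-leaves (_∷_ {y = inj₂ _} (refl , a) [])      ne na = ⊥-elim (na (refl , a))
  wlength-project-between-leaves (_∷_ {y = inj₂ _} (refl , a) (e ∷ Q)) ne na =
    s≤s (s≤s (wlength-project-into-leaf {inj₂ _} e Q))

  lift-project-or-shorter : ∀ {x y} (P : Walk (G ⊙ H) (inj₁ x) (inj₁ y)) →
                            P ≡ lift (project P) ⊎ wlength (project P) < wlength P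
  lift-project-or-shorter []                        = inj₁ refl
  lift-project-or-shorter (_∷_ {y = inj₁ _} e P)    = Sum.map (cong (e ∷_)) s≤s (lift-project-or-shorter P)
  lift-project-or-shorter (_∷_ {y = inj₂ _} refl P) = inj₂ (s≤s (wlength-project P))

  lift-shortest : ∀ {a b} {W : Walk G a b} → IsShortest W → IsShortest (lift W)
  lift-shortest {W = W} W-shortest Q = begin
    wlength (lift W)    ≡⟨ wlength-lift W ⟩
    wlength W           ≤⟨ W-shortest (project Q) ⟩
    wlength (project Q) ≤⟨ wlength-project Q ⟩
    wlength Q           ∎
    where open ≤-Reasoning

  lift-shortest⁻ : ∀ {a b} {W : Walk G a b} → IsShortest (lift W) → IsShortest W
  lift-shortest⁻ {W = W} lift-W-shortest Q = begin
    wlength W        ≡⟨ sym (wlength-lift W) ⟩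
    wlength (lift W) ≤⟨ lift-W-shortest (lift Q) ⟩
    wlength (lift Q) ≡⟨ wlength-lift Q ⟩
    wlength Q        ∎
    where open ≤-Reasoning

  shortest-stays-in-G : ∀ {x y} {P : Walk (G ⊙ H) (inj₁ x) (inj₁ y)} →
                        IsShortest P → P ≡ lift (project P)
  shortest-stays-in-G {P = P} P-shortest with lift-project-or-shorter P
  ... | inj₁ P≡lift = P≡lift
  ... | inj₂ shorter = ⊥-elim (<⇒≱ shorter
          (subst (wlength P ≤_) (wlength-lift (project P)) (P-shortest (lift (project P)))))

  restrict-visible : ∀ (T : V (G ⊙ H) → Set) {x y} →
                     Visible (G ⊙ H) T (inj₁ x) (inj₁ y) → Visible G (λ v → T (inj₁ v)) x y
  restrict-visible T (P , P-shortest , P-avoids) =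
    project P , lift-shortest⁻ (subst IsShortest P≡lift P-shortest) , avoids
    where
    P≡lift = shortest-stays-in-G P-shortest
    verts-P : verts P ≡ map inj₁ (verts (project P))
    verts-P = trans (cong verts P≡lift) (verts-lift (project P))
    avoids : ∀ v → v ∈ verts (project P) → T (inj₁ v) → (v ≡ _) ⊎ (v ≡ _)
    avoids v v∈ Tv = Sum.map inj₁-injective inj₁-injective
      (P-avoids (inj₁ v) (subst (inj₁ v ∈_) (sym verts-P) (∈-map⁺ inj₁ v∈)) Tv)

  restrict-colourable : ∀ {k} → MVColorable (G ⊙ H) k → MVColorable G k
  restrict-colourable (c , c-mv) =
    (λ v → c (inj₁ v)) ,
    λ i x y cx cy x≢y → restrict-visible (λ v → c v ≡ i) (c-mv i _ _ cx cy (x≢y ∘ inj₁-injective))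

  lift-visible : ∀ (S : V G → Set) (T : V (G ⊙ H) → Set) → (∀ v → T (inj₁ v) → S v) →
                 ∀ {x y} → Visible G S x y → Visible (G ⊙ H) T (inj₁ x) (inj₁ y)
  lift-visible S T T⊆S (W , W-shortest , W-avoids) = lift W , lift-shortest W-shortest , avoids
    where
    avoids : ∀ v → v ∈ verts (lift W) → T v → (v ≡ _) ⊎ (v ≡ _)
    avoids v v∈ Tv with ∈-map⁻ inj₁ (subst (v ∈_) (verts-lift W) v∈)
    ... | w , w∈ , refl = Sum.map (cong inj₁) (cong inj₁) (W-avoids w w∈ (T⊆S w Tv))

  leaf-path : ∀ {i j} h h' → Walk G i j → Walk (G ⊙ H) (leaf i h) (leaf j h')
  leaf-path {i} h h' W = _∷_ {y = inj₁ i} refl (lift W ∷ʳ refl)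

  leaf-path-shortest : ∀ {i j h h'} {W : Walk G i j} → IsShortest W →
                       ¬ leaf i h ≡ leaf j h' → ¬ _~_ (G ⊙ H) (leaf i h) (leaf j h') →
                       IsShortest (leaf-path h h' W)
  leaf-path-shortest {W = W} W-shortest ne na Q = begin
    suc (wlength (lift W ∷ʳ refl)) ≡⟨ cong suc (wlength-∷ʳ (lift W) refl) ⟩
    suc (suc (wlength (lift W)))   ≡⟨ cong (λ n → suc (suc n)) (wlength-lift W) ⟩
    suc (suc (wlength W))          ≤⟨ s≤s (s≤s (W-shortest (project Q))) ⟩
    suc (suc (wlength (project Q))) ≤⟨ wlength-project-between-leaves Q ne na ⟩
    wlength Q                      ∎
    where open ≤-Reasoning

  leaves-visible : ∀ (T : V (G ⊙ H) → Set) → (∀ v → ¬ T (inj₁ v)) →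
                   ∀ {i j h h'} → Shortest G i j → Dec (_~_ (G ⊙ H) (leaf i h) (leaf j h')) →
                   ¬ leaf i h ≡ leaf j h' → Visible (G ⊙ H) T (leaf i h) (leaf j h')
  leaves-visible T T∩G=∅ _ (yes e) ne = e ∷ [] , edge-shortest {G ⊙ H} ne e , avoids
    where
    avoids : ∀ v → v ∈ verts {G ⊙ H} (e ∷ []) → T v → (v ≡ _) ⊎ (v ≡ _)
    avoids v (here v≡x)         _ = inj₁ v≡x
    avoids v (there (here v≡y)) _ = inj₂ v≡y
  leaves-visible T T∩G=∅ {h = h} {h'} (W , W-shortest) (no na) ne =
    leaf-path h h' W , leaf-path-shortest W-shortest ne na , avoids
    where
    avoids : ∀ v → v ∈ verts (leaf-path h h' W) → T v → (v ≡ _) ⊎ (v ≡ _)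
    avoids v (here v≡x) _ = inj₁ v≡x
    avoids v (there v∈) Tv with ∈-verts-∷ʳ⁻ (lift W) refl v∈
    ... | inj₂ v≡y = inj₂ v≡y
    ... | inj₁ v∈lift with ∈-map⁻ inj₁ (subst (v ∈_) (verts-lift W) v∈lift)
    ...   | w , _ , refl = ⊥-elim (T∩G=∅ w Tv)

  extend-colourable : ∀ {n} → MVColorable G n → (∀ x y → Shortest G x y) →
                      (∀ i j h h' → Dec (_~_ (G ⊙ H) (leaf i h) (leaf j h'))) →
                      MVColorable (G ⊙ H) (suc n)
  extend-colourable (c , c-mv) shortest adjacent? = c⁺ , c⁺-mv
    where
    c⁺ : V (G ⊙ H) → Fin _
    c⁺ (inj₁ v) = suc (c v)
    c⁺ (inj₂ _) = zero

    c⁺-mv : ∀ k → MutualVisibility (G ⊙ H) (λ v → c⁺ v ≡ k)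
    c⁺-mv zero    (inj₂ (i , h)) (inj₂ (j , h')) _  _  ne =
      leaves-visible _ (λ v ()) (shortest i j) (adjacent? i j h h') ne
    c⁺-mv (suc k) (inj₁ x) (inj₁ y) cx cy ne =
      lift-visible _ _ (λ v → suc-injective)
        (c-mv k x y (suc-injective cx) (suc-injective cy) (ne ∘ cong inj₁))
    c⁺-mv zero    (inj₁ _) _        ()
    c⁺-mv zero    (inj₂ _) (inj₁ _) _  ()
    c⁺-mv (suc k) (inj₂ _) _        ()
    c⁺-mv (suc k) (inj₁ _) (inj₂ _) _  ()

proposition6p1 : (G H : Graph) → Finite G → Finite H → Connected G → OrderAtLeastTwo G → V H → (a b : ℕ) → IsChiMu G a → IsChiMu (G ⊙ H) b → (a ≤ b) × (b ≤ suc a)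
proposition6p1 G H finG finH conG _ _ a b (colourG , minimalG) (colourGH , minimalGH) =
  minimalG b (restrict-colourable colourGH) ,
  decidable-stable (b ≤? suc a) (¬¬-map (minimalGH (suc a)) extended)
  where
  open Corona G H
  extended : DoubleNegation (MVColorable (G ⊙ H) (suc a))
  extended = do
    shortest  ← ¬¬-pull finG λ x → ¬¬-pull finG λ y → ¬¬-shortest (conG x y)
    adjacent? ← ¬¬-pull finG λ i → ¬¬-pull finG λ j → ¬¬-pull finH λ h → ¬¬-pull finH λ h' →
                  ¬¬-excluded-middle
    pure (extend-colourable colourG shortest adjacent?)
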